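{- For every integer $n\geq 3$, $\kappa_{3}(Q_{n}^{3})\leq 8n-12$.
   Context: The $3$-ary $n$-cube $Q_n^3$ is the graph whose vertices are the strings $u=u_{n-1}u_{n-2}\cdots u_0$ with $u_i\in\{0,1,2\}$, two vertices $u,v$ being adjacent if and only if there is an index $j$ with $u_j=v_j\pm 1 \pmod 3$ and $u_i=v_i$ for all $i\neq j$. For a connected graph $G$ and an integer $h\geq 0$, a vertex set $S\subseteq V(G)$ is an $h$-extra vertex cut if $G-S$ is disconnected and every component of $G-S$ has at least $h+1$ vertices; the $h$-extra connectivity $\kappa_h(G)$ is the minimum cardinality of an $h$-extra vertex cut of $G$. -}

module Defs where

open import Level using (Level; _⊔_)
open import Data.Nat using (ℕ; suc; _≤_)
open import Data.Fin using (Fin; zero; suc)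
open import Data.Vec using (Vec; lookup)
open import Data.List using (List; length)
open import Data.List.Membership.Propositional using (_∈_; _∉_)
open import Data.List.Relation.Unary.All using (All)
open import Data.List.Relation.Unary.Unique.Propositional using (Unique)
open import Data.Product using (Σ; ∃; _×_; ∃-syntax)
open import Data.Sum using (_⊎_)
open import Relation.Nullary using (¬_)
open import Relation.Binary.PropositionalEquality using (_≡_; _≢_)
open import Relation.Binary.Construct.Closure.ReflexiveTransitive using (Star)

record Graph : Set₁ where
  field
    Vertex : Set
    Adj    : Vertex → Vertex → Set

open Graph public

record VSet (G : Graph) : Set where
  field
    elems  : List (Vertex G)
    unique : Unique elems

open VSet public

∣_∣ : {G : Graph} → VSet G → ℕ
∣ S ∣ = length (elems S)

AdjMinus : (G : Graph) → VSet G → Vertex G → Vertex G → Set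
AdjMinus G S u v = u ∉ elems S × v ∉ elems S × Adj G u v

ConnMinus : (G : Graph) → VSet G → Vertex G → Vertex G → Set
ConnMinus G S = Star (AdjMinus G S)

DisconnectedMinus : (G : Graph) → VSet G → Set
DisconnectedMinus G S =
  ∃[ u ] ∃[ v ] (u ∉ elems S × v ∉ elems S × ¬ ConnMinus G S u v)

ComponentAtLeast : (G : Graph) → VSet G → Vertex G → ℕ → Set
ComponentAtLeast G S u k =
  ∃[ C ] (Unique C × k ≤ length C ×
          All (λ w → w ∉ elems S × ConnMinus G S u w) C)

IsExtraCut : (G : Graph) → ℕ → VSet G → Set
IsExtraCut G h S =
  DisconnectedMinus G S ×
  (∀ u → u ∉ elems S → ComponentAtLeast G S u (suc h))

-- κ_h(G) ≤ m : since κ_h(G) is the minimum cardinality of an h-extra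
-- vertex cut, this says some h-extra vertex cut has cardinality ≤ m.
κ_≤_ : (G : Graph) → ℕ → ℕ → Set
κ_≤_ G h m = Σ (VSet G) λ S → IsExtraCut G h S × ∣ S ∣ ≤ m

inc3 : Fin 3 → Fin 3
inc3 zero             = suc zero
inc3 (suc zero)       = suc (suc zero)
inc3 (suc (suc zero)) = zero

dec3 : Fin 3 → Fin 3
dec3 zero             = suc (suc zero)
dec3 (suc zero)       = zero
dec3 (suc (suc zero)) = suc zero

AdjQ3 : (n : ℕ) → Vec (Fin 3) n → Vec (Fin 3) n → Set
AdjQ3 n u v =
  ∃[ j ] ((lookup u j ≡ inc3 (lookup v j) ⊎ lookup u j ≡ dec3 (lookup v j)) ×
          (∀ i → i ≢ j → lookup u i ≡ lookup v i))

Q3 : ℕ → Graph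
Q3 n = record { Vertex = Vec (Fin 3) n ; Adj = AdjQ3 n }

-- Write vertices of Q_{m+2}^3 as u ++ a with u ∈ Q_2^3 and a ∈ Q_m^3, and
-- let H be the 4-cycle {0,1}² × {0}.  Its neighbourhood consists of the
-- 4 vertices of Q_2^3 with exactly one coordinate 2 (times 0), and of
-- {0,1}² × N(0), which has 4·2m vertices: 8n − 12 in all.  Removing it
-- isolates H.  A vertex u ++ a with a 2 in u lies in the cut only if a = 0,
-- so every other vertex u ++ a with a ≠ 0 reaches 22 ++ a through such
-- vertices, and 22 ++ 0 is adjacent to 22 ++ 10…0; hence every component
-- has at least 4 vertices.
module Submission where

open import Defs
open import Data.Nat using (ℕ; zero; suc; _+_; _*_; _∸_; _≤_; s≤s)
open import Data.Nat.Properties using (≤-refl; ≤-reflexive; n≤1+n; *-suc; *-assoc; *-distribˡ-+)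
open import Data.Fin using (Fin; zero; suc)
open import Data.Fin.Properties using (_≟_; suc-injective)
open import Data.Vec using (Vec; []; _∷_; _++_; replicate)
open import Data.Vec.Properties using (∷-injectiveʳ; ++-injectiveˡ; ++-injective; ≡-dec)
open import Data.Vec.Relation.Binary.Pointwise.Extensional using (ext; Pointwise-≡⇒≡)
open import Data.List using (List; []; _∷_; map; length; cartesianProductWith)
import Data.List as List
open import Data.List.Properties using (length-map; length-++)
open import Data.List.Membership.Propositional using (_∈_; _∉_)
open import Data.List.Membership.Propositional.Properties
  using (∈-map⁺; ∈-map⁻; ∈-++⁺ˡ; ∈-++⁺ʳ; ∈-++⁻; ∈-cartesianProductWith⁺; ∈-cartesianProductWith⁻)
open import Data.List.Relation.Unary.Any using (here; there)
open import Data.List.Relation.Unary.All using (All; []; _∷_; all?)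
import Data.List.Relation.Unary.All as All
import Data.List.Relation.Unary.All.Properties as All
open import Data.List.Relation.Unary.AllPairs using ([]; _∷_)
open import Data.List.Relation.Unary.Unique.Propositional using (Unique)
import Data.List.Relation.Unary.Unique.Propositional.Properties as Unique
open import Data.Product using (∃; _×_; _,_)
open import Data.Sum using (_⊎_; inj₁; inj₂)
open import Data.Empty using (⊥-elim)
open import Function using (_∘_)
open import Relation.Nullary using (¬_; yes; no)
open import Relation.Nullary.Decidable using (¬?; from-yes; from-no)
open import Relation.Binary.Definitions using (DecidableEquality)
open import Relation.Binary.PropositionalEquality
open import Relation.Binary.Construct.Closure.ReflexiveTransitive using (ε; _◅_; _◅◅_; reverse)

module Components (G : Graph) (adj-sym : ∀ {x y} → Adj G x y → Adj G y x) (S : VSet G) where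

  ConnMinus-sym : ∀ {u v} → ConnMinus G S u v → ConnMinus G S v u
  ConnMinus-sym = reverse λ (x∉S , y∉S , xy) → y∉S , x∉S , adj-sym xy

  componentAtLeast-◅◅ : ∀ {u v k} → ConnMinus G S u v → ComponentAtLeast G S v k →
                        ComponentAtLeast G S u k
  componentAtLeast-◅◅ u⇝v (C , unique , k≤ , reached) =
    C , unique , k≤ , All.map (λ (w∉S , v⇝w) → w∉S , u⇝v ◅◅ v⇝w) reached

  componentAtLeast-hub : ∀ h {k C} → Unique C → k ≤ length C →
                         All (λ w → w ∉ elems S × ConnMinus G S w h) C →
                         ComponentAtLeast G S h k
  componentAtLeast-hub _ unique k≤ to-hub =
    _ , unique , k≤ , All.map (λ (w∉S , w⇝h) → w∉S , ConnMinus-sym w⇝h) to-hub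

ConnMinus-closed : ∀ (G : Graph) S (P : Vertex G → Set) →
                   (∀ {x y} → y ∉ elems S → Adj G x y → P x → P y) →
                   ∀ {u v} → ConnMinus G S u v → P u → P v
ConnMinus-closed G S P step ε           pu = pu
ConnMinus-closed G S P step ((_ , y∉S , xy) ◅ w) pu =
  ConnMinus-closed G S P step w (step y∉S xy pu)

length-cartesianProductWith : ∀ {A B C : Set} (f : A → B → C) xs ys →
  length (cartesianProductWith f xs ys) ≡ length xs * length ys
length-cartesianProductWith f []       ys = refl
length-cartesianProductWith f (x ∷ xs) ys = begin
  length (map (f x) ys List.++ cartesianProductWith f xs ys)
    ≡⟨ length-++ (map (f x) ys) ⟩
  length (map (f x) ys) + length (cartesianProductWith f xs ys)
    ≡⟨ cong₂ _+_ (length-map (f x) ys) (length-cartesianProductWith f xs ys) ⟩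
  length ys + length xs * length ys ∎
  where open ≡-Reasoning

Word : ℕ → Set
Word n = Vec (Fin 3) n

pattern 0₃ = zero
pattern 1₃ = suc zero
pattern 2₃ = suc (suc zero)

origin : ∀ {n} → Word n
origin = replicate _ 0₃

≢⇒inc∨dec : ∀ {x y} → x ≢ y → x ≡ inc3 y ⊎ x ≡ dec3 y
≢⇒inc∨dec {0₃} {0₃} x≢y = ⊥-elim (x≢y refl)
≢⇒inc∨dec {0₃} {1₃} _   = inj₂ refl
≢⇒inc∨dec {0₃} {2₃} _   = inj₁ refl
≢⇒inc∨dec {1₃} {0₃} _   = inj₁ refl
≢⇒inc∨dec {1₃} {1₃} x≢y = ⊥-elim (x≢y refl)
≢⇒inc∨dec {1₃} {2₃} _   = inj₂ refl
≢⇒inc∨dec {2₃} {0₃} _   = inj₂ refl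
≢⇒inc∨dec {2₃} {1₃} _   = inj₁ refl
≢⇒inc∨dec {2₃} {2₃} x≢y = ⊥-elim (x≢y refl)

inc∨dec⇒≢ : ∀ {x y} → x ≡ inc3 y ⊎ x ≡ dec3 y → x ≢ y
inc∨dec⇒≢ {y = 0₃} (inj₁ ()) refl
inc∨dec⇒≢ {y = 0₃} (inj₂ ()) refl
inc∨dec⇒≢ {y = 1₃} (inj₁ ()) refl
inc∨dec⇒≢ {y = 1₃} (inj₂ ()) refl
inc∨dec⇒≢ {y = 2₃} (inj₁ ()) refl
inc∨dec⇒≢ {y = 2₃} (inj₂ ()) refl

adj-head : ∀ {n x y} {u : Word n} → x ≢ y → AdjQ3 (suc n) (x ∷ u) (y ∷ u)
adj-head x≢y = zero , ≢⇒inc∨dec x≢y , λ where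
  zero    i≢0 → ⊥-elim (i≢0 refl)
  (suc i) _   → refl

adj-tail : ∀ {n x} {u v : Word n} → AdjQ3 n u v → AdjQ3 (suc n) (x ∷ u) (x ∷ v)
adj-tail (j , step , same) = suc j , step , λ where
  zero    _   → refl
  (suc i) i≢j → same i (i≢j ∘ cong suc)

adj-∷⁻ : ∀ {n x y} {u v : Word n} → AdjQ3 (suc n) (x ∷ u) (y ∷ v) →
         (x ≢ y × u ≡ v) ⊎ (x ≡ y × AdjQ3 n u v)
adj-∷⁻ (zero  , step , same) =
  inj₁ (inc∨dec⇒≢ step , Pointwise-≡⇒≡ (ext λ i → same (suc i) λ ()))
adj-∷⁻ (suc j , step , same) =
  inj₂ (same zero (λ ()) , j , step , λ i i≢j → same (suc i) (i≢j ∘ suc-injective))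

adj-sym : ∀ {n} {u v : Word n} → AdjQ3 n u v → AdjQ3 n v u
adj-sym {u = []}    (() , _)
adj-sym {u = _ ∷ u} {_ ∷ v} uv with adj-∷⁻ uv
... | inj₁ (x≢y , refl) = adj-head λ y≡x → x≢y (sym y≡x)
... | inj₂ (refl , uv′) = adj-tail (adj-sym {u = u} {v} uv′)

adj-++⁻ : ∀ {k m} (u v : Word k) {a b : Word m} → AdjQ3 (k + m) (u ++ a) (v ++ b) →
          (AdjQ3 k u v × a ≡ b) ⊎ (u ≡ v × AdjQ3 m a b)
adj-++⁻ []      []      ab = inj₂ (refl , ab)
adj-++⁻ (x ∷ u) (y ∷ v) uv with adj-∷⁻ uv
... | inj₁ (x≢y , eq) with ++-injective u v eq
...   | refl , refl = inj₁ (adj-head x≢y , refl)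
adj-++⁻ (x ∷ u) (y ∷ v) uv | inj₂ (refl , uv′) with adj-++⁻ u v uv′
... | inj₁ (uv″ , a≡b) = inj₁ (adj-tail uv″ , a≡b)
... | inj₂ (refl , ab) = inj₂ (refl , ab)

neighboursOfOrigin : (m : ℕ) → List (Word m)
neighboursOfOrigin zero    = []
neighboursOfOrigin (suc m) =
  (1₃ ∷ origin) ∷ (2₃ ∷ origin) ∷ map (0₃ ∷_) (neighboursOfOrigin m)

neighboursOfOrigin-unique : ∀ m → Unique (neighboursOfOrigin m)
neighboursOfOrigin-unique zero    = []
neighboursOfOrigin-unique (suc m) =
  ((λ ()) ∷ All.map⁺ (All.universal (λ _ ()) _)) ∷
  All.map⁺ (All.universal (λ _ ()) _) ∷
  Unique.map⁺ ∷-injectiveʳ (neighboursOfOrigin-unique m)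

length-neighboursOfOrigin : ∀ m → length (neighboursOfOrigin m) ≡ 2 * m
length-neighboursOfOrigin zero    = refl
length-neighboursOfOrigin (suc m) = begin
  2 + length (map (0₃ ∷_) (neighboursOfOrigin m))
    ≡⟨ cong (2 +_) (length-map (0₃ ∷_) (neighboursOfOrigin m)) ⟩
  2 + length (neighboursOfOrigin m) ≡⟨ cong (2 +_) (length-neighboursOfOrigin m) ⟩
  2 + 2 * m                         ≡⟨ *-suc 2 m ⟨
  2 * suc m                         ∎
  where open ≡-Reasoning

origin∉neighboursOfOrigin : ∀ {m} → origin ∉ neighboursOfOrigin m
origin∉neighboursOfOrigin {suc m} (there (there p)) with ∈-map⁻ (0₃ ∷_) p
... | a , a∈ , eq = origin∉neighboursOfOrigin (subst (_∈ _) (sym (∷-injectiveʳ eq)) a∈)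

adj-origin⇒∈neighboursOfOrigin : ∀ {m} {a : Word m} → AdjQ3 m origin a →
                                 a ∈ neighboursOfOrigin m
adj-origin⇒∈neighboursOfOrigin {zero}  (() , _)
adj-origin⇒∈neighboursOfOrigin {suc m} {0₃ ∷ a} oa with adj-∷⁻ oa
... | inj₁ (0≢0 , _)  = ⊥-elim (0≢0 refl)
... | inj₂ (_ , oa′) = there (there (∈-map⁺ (0₃ ∷_) (adj-origin⇒∈neighboursOfOrigin oa′)))
adj-origin⇒∈neighboursOfOrigin {suc m} {1₃ ∷ a} oa with adj-∷⁻ oa
... | inj₁ (_ , refl) = here refl
... | inj₂ (() , _)
adj-origin⇒∈neighboursOfOrigin {suc m} {2₃ ∷ a} oa with adj-∷⁻ oa
... | inj₁ (_ , refl) = there (here refl)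
... | inj₂ (() , _)

pattern ⟨_,_⟩ b c = b ∷ c ∷ []

_≟₂_ : DecidableEquality (Word 2)
_≟₂_ = ≡-dec _≟_

open import Data.List.Membership.DecPropositional _≟₂_ using (_∈?_)
open import Data.List.Relation.Unary.Unique.DecPropositional _≟₂_ using (unique?)

square ∂square offSquare : List (Word 2)
square    = ⟨ 0₃ , 0₃ ⟩ ∷ ⟨ 0₃ , 1₃ ⟩ ∷ ⟨ 1₃ , 0₃ ⟩ ∷ ⟨ 1₃ , 1₃ ⟩ ∷ []
∂square   = ⟨ 2₃ , 0₃ ⟩ ∷ ⟨ 2₃ , 1₃ ⟩ ∷ ⟨ 0₃ , 2₃ ⟩ ∷ ⟨ 1₃ , 2₃ ⟩ ∷ []
offSquare = ⟨ 2₃ , 2₃ ⟩ ∷ ∂square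

corner : Word 2
corner = ⟨ 2₃ , 2₃ ⟩

square-unique : Unique square
square-unique = from-yes (unique? square)

∂square-unique : Unique ∂square
∂square-unique = from-yes (unique? ∂square)

offSquare-unique : Unique offSquare
offSquare-unique = from-yes (unique? offSquare)

offSquare∩square≡∅ : ∀ {u} → u ∈ offSquare → u ∉ square
offSquare∩square≡∅ = All.lookup (from-yes (all? (λ u → ¬? (u ∈? square)) offSquare))

corner∉∂square : corner ∉ ∂square
corner∉∂square = from-no (corner ∈? ∂square)

⟨_,2⟩∉square : ∀ b → ⟨ b , 2₃ ⟩ ∉ square
⟨ b ,2⟩∉square (here ())
⟨ b ,2⟩∉square (there (here ()))
⟨ b ,2⟩∉square (there (there (here ())))
⟨ b ,2⟩∉square (there (there (there (here ()))))
⟨ b ,2⟩∉square (there (there (there (there ()))))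

⟨2,_⟩∉square : ∀ c → ⟨ 2₃ , c ⟩ ∉ square
⟨2, c ⟩∉square (here ())
⟨2, c ⟩∉square (there (here ()))
⟨2, c ⟩∉square (there (there (here ())))
⟨2, c ⟩∉square (there (there (there (here ()))))
⟨2, c ⟩∉square (there (there (there (there ()))))

classify : ∀ u → u ∈ square ⊎ u ∈ ∂square ⊎ u ≡ corner
classify ⟨ 0₃ , 0₃ ⟩ = inj₁ (here refl)
classify ⟨ 0₃ , 1₃ ⟩ = inj₁ (there (here refl))
classify ⟨ 1₃ , 0₃ ⟩ = inj₁ (there (there (here refl)))
classify ⟨ 1₃ , 1₃ ⟩ = inj₁ (there (there (there (here refl))))
classify ⟨ 2₃ , 0₃ ⟩ = inj₂ (inj₁ (here refl))
classify ⟨ 2₃ , 1₃ ⟩ = inj₂ (inj₁ (there (here refl)))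
classify ⟨ 0₃ , 2₃ ⟩ = inj₂ (inj₁ (there (there (here refl))))
classify ⟨ 1₃ , 2₃ ⟩ = inj₂ (inj₁ (there (there (there (here refl)))))
classify ⟨ 2₃ , 2₃ ⟩ = inj₂ (inj₂ refl)

square-closed : ∀ {u v} → u ∈ square → AdjQ3 2 u v → v ∈ square ⊎ v ∈ ∂square
square-closed {⟨ b , c ⟩} {v} u∈ uv with classify v
... | inj₁ v∈          = inj₁ v∈
... | inj₂ (inj₁ v∈)   = inj₂ v∈
... | inj₂ (inj₂ refl) with adj-∷⁻ uv
...   | inj₁ (_ , refl) = ⊥-elim (⟨ b ,2⟩∉square u∈)
...   | inj₂ (refl , _) = ⊥-elim (⟨2, c ⟩∉square u∈)

cut : (m : ℕ) → List (Word (2 + m))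
cut m = map (_++ origin) ∂square List.++ cartesianProductWith _++_ square (neighboursOfOrigin m)

cut-unique : ∀ m → Unique (cut m)
cut-unique m = Unique.++⁺
  (Unique.map⁺ {f = _++ origin {m}} (++-injectiveˡ _ _) ∂square-unique)
  (Unique.cartesianProductWith⁺ _++_ (++-injective _ _) square-unique (neighboursOfOrigin-unique m))
  disjoint
  where
  disjoint : ∀ {v} → ¬ (v ∈ map (_++ origin {m}) ∂square ×
                        v ∈ cartesianProductWith _++_ square (neighboursOfOrigin m))
  disjoint (p , q)
    with ∈-map⁻ (_++ origin {m}) p | ∈-cartesianProductWith⁻ _++_ square (neighboursOfOrigin m) q
  ... | u , u∈∂square , refl | u′ , _ , u′∈square , _ , eq with ++-injectiveˡ u u′ eq
  ...   | refl = offSquare∩square≡∅ (there u∈∂square) u′∈square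

length-cut : ∀ m → length (cut m) ≡ 8 * (2 + m) ∸ 12
length-cut m = begin
  4 + length (cartesianProductWith _++_ square (neighboursOfOrigin m))
    ≡⟨ cong (4 +_) (length-cartesianProductWith _++_ square (neighboursOfOrigin m)) ⟩
  4 + 4 * length (neighboursOfOrigin m) ≡⟨ cong (λ l → 4 + 4 * l) (length-neighboursOfOrigin m) ⟩
  4 + 4 * (2 * m)                       ≡⟨ cong (4 +_) (*-assoc 4 2 m) ⟨
  (8 * 2 + 8 * m) ∸ 12                  ≡⟨ cong (_∸ 12) (*-distribˡ-+ 8 2 m) ⟨
  8 * (2 + m) ∸ 12                      ∎
  where open ≡-Reasoning

cutSet : (m : ℕ) → VSet (Q3 (2 + m))
cutSet m = record { elems = cut m ; unique = cut-unique m }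

module _ {m : ℕ} where

  ∈cut-∂square : ∀ {u} → u ∈ ∂square → u ++ origin ∈ cut m
  ∈cut-∂square u∈ = ∈-++⁺ˡ (∈-map⁺ (_++ origin) u∈)

  ∈cut-square : ∀ {u a} → u ∈ square → a ∈ neighboursOfOrigin m → u ++ a ∈ cut m
  ∈cut-square u∈ a∈ = ∈-++⁺ʳ (map (_++ origin) ∂square) (∈-cartesianProductWith⁺ _++_ u∈ a∈)

  ∉cut : ∀ {u a} → (u ∈ ∂square → a ≢ origin) → (u ∈ square → a ∉ neighboursOfOrigin m) →
         u ++ a ∉ cut m
  ∉cut {u} not-∂square not-square v∈ with ∈-++⁻ (map (_++ origin) ∂square) v∈
  ... | inj₁ p with ∈-map⁻ (_++ origin) p
  ...   | u′ , u′∈ , eq with ++-injective u u′ eq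
  ...     | refl , refl = not-∂square u′∈ refl
  ∉cut {u} not-∂square not-square v∈ | inj₂ q
    with ∈-cartesianProductWith⁻ _++_ square (neighboursOfOrigin m) q
  ... | u′ , a′ , u′∈ , a′∈ , eq with ++-injective u u′ eq
  ...   | refl , refl = not-square u′∈ a′∈

  square-free : ∀ {u} → u ∈ square → u ++ origin ∉ cut m
  square-free u∈ = ∉cut (λ u∈∂square _ → offSquare∩square≡∅ (there u∈∂square) u∈)
                        (λ _ → origin∉neighboursOfOrigin)

  offSquare-free : ∀ {u a} → u ∉ square → a ≢ origin → u ++ a ∉ cut m
  offSquare-free u∉ a≢0 = ∉cut (λ _ → a≢0) (λ u∈ → ⊥-elim (u∉ u∈))

  corner-free : corner ++ origin ∉ cut m
  corner-free = ∉cut (λ c∈ _ → corner∉∂square c∈) (λ c∈ _ → ⟨2, 2₃ ⟩∉square c∈)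

  open Components (Q3 (2 + m)) (λ {u} {v} → adj-sym {u = u} {v}) (cutSet m)

  private
    _⇝_ : Word (2 + m) → Word (2 + m) → Set
    _⇝_ = ConnMinus (Q3 (2 + m)) (cutSet m)

    step : ∀ {x y} → x ∉ cut m → y ∉ cut m → AdjQ3 (2 + m) x y → x ⇝ y
    step x∉ y∉ xy = (x∉ , y∉ , xy) ◅ ε

  InSquare : Word (2 + m) → Set
  InSquare v = ∃ λ u → u ∈ square × v ≡ u ++ origin

  inSquare-step : ∀ {x y} → y ∉ cut m → AdjQ3 (2 + m) x y → InSquare x → InSquare y
  inSquare-step {y = b ∷ c ∷ a} y∉ xy (u , u∈ , refl) with adj-++⁻ u ⟨ b , c ⟩ xy
  ... | inj₂ (refl , 0a) = ⊥-elim (y∉ (∈cut-square u∈ (adj-origin⇒∈neighboursOfOrigin 0a)))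
  ... | inj₁ (uv , refl) with square-closed u∈ uv
  ...   | inj₁ v∈square  = _ , v∈square , refl
  ...   | inj₂ v∈∂square = ⊥-elim (y∉ (∈cut-∂square v∈∂square))

  cut-disconnects : DisconnectedMinus (Q3 (2 + m)) (cutSet m)
  cut-disconnects =
    origin , corner ++ origin , square-free (here refl) , corner-free ,
    λ w → corner∉H (ConnMinus-closed _ (cutSet m) InSquare inSquare-step w (_ , here refl , refl))
    where
    corner∉H : ¬ InSquare (corner ++ origin)
    corner∉H (u , u∈ , eq) =
      ⟨2, 2₃ ⟩∉square (subst (_∈ square) (sym (++-injectiveˡ corner u eq)) u∈)

  square-to-origin : ∀ {u} → u ∈ square → (u ++ origin) ⇝ origin
  square-to-origin (here refl) = ε
  square-to-origin (there (here refl)) =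
    step (square-free (there (here refl))) (square-free (here refl)) (adj-tail (adj-head λ ()))
  square-to-origin (there (there (here refl))) =
    step (square-free (there (there (here refl)))) (square-free (here refl)) (adj-head λ ())
  square-to-origin (there (there (there (here refl)))) =
    step (square-free (there (there (there (here refl))))) (square-free (there (here refl)))
         (adj-head λ ())
    ◅◅ square-to-origin (there (here refl))

  square-component : ∀ {u} → u ∈ square →
                     ComponentAtLeast (Q3 (2 + m)) (cutSet m) (u ++ origin) 4
  square-component u∈ = componentAtLeast-◅◅ (square-to-origin u∈)
    (componentAtLeast-hub origin (Unique.map⁺ {f = _++ origin {m}} (++-injectiveˡ _ _) square-unique)
      ≤-refl
      (All.map⁺ (All.tabulate λ w∈ → square-free w∈ , square-to-origin w∈)))

  column-to-corner : ∀ {a} → a ≢ origin → ∀ b → (⟨ b , 2₃ ⟩ ++ a) ⇝ (corner ++ a)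
  column-to-corner a≢0 2₃ = ε
  column-to-corner a≢0 0₃ =
    step (offSquare-free ⟨ 0₃ ,2⟩∉square a≢0) (offSquare-free ⟨2, 2₃ ⟩∉square a≢0) (adj-head λ ())
  column-to-corner a≢0 1₃ =
    step (offSquare-free ⟨ 1₃ ,2⟩∉square a≢0) (offSquare-free ⟨2, 2₃ ⟩∉square a≢0) (adj-head λ ())

  to-corner : ∀ {a} → a ≢ origin → ∀ u → u ++ a ∉ cut m → (u ++ a) ⇝ (corner ++ a)
  to-corner a≢0 ⟨ b , 2₃ ⟩ _  = column-to-corner a≢0 b
  to-corner a≢0 ⟨ b , 0₃ ⟩ u∉ =
    step u∉ (offSquare-free ⟨ b ,2⟩∉square a≢0) (adj-tail (adj-head λ ())) ◅◅ column-to-corner a≢0 b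
  to-corner a≢0 ⟨ b , 1₃ ⟩ u∉ =
    step u∉ (offSquare-free ⟨ b ,2⟩∉square a≢0) (adj-tail (adj-head λ ())) ◅◅ column-to-corner a≢0 b

  far-component : ∀ {u a} → a ≢ origin → u ++ a ∉ cut m →
                  ComponentAtLeast (Q3 (2 + m)) (cutSet m) (u ++ a) 4
  far-component {u} {a} a≢0 u∉ = componentAtLeast-◅◅ (to-corner a≢0 u u∉)
    (componentAtLeast-hub (corner ++ a) (Unique.map⁺ {f = _++ a} (++-injectiveˡ _ _) offSquare-unique)
      (n≤1+n 4)
      (All.map⁺ (All.tabulate λ {w} w∈ →
        let w∉ = offSquare-free (offSquare∩square≡∅ w∈) a≢0 in w∉ , to-corner a≢0 w w∉)))

  corner-component : ∀ {a} → AdjQ3 m origin a →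
                     ComponentAtLeast (Q3 (2 + m)) (cutSet m) (corner ++ origin) 4
  corner-component {a} 0a =
    componentAtLeast-◅◅ (step corner-free a-free (adj-tail (adj-tail 0a)))
      (far-component a≢0 a-free)
    where
    a≢0 : a ≢ origin
    a≢0 refl = origin∉neighboursOfOrigin (adj-origin⇒∈neighboursOfOrigin 0a)
    a-free : corner ++ a ∉ cut m
    a-free = offSquare-free ⟨2, 2₃ ⟩∉square a≢0

cut-component : ∀ k v → v ∉ cut (suc k) → ComponentAtLeast (Q3 (3 + k)) (cutSet (suc k)) v 4
cut-component k (b ∷ c ∷ a) v∉ with ≡-dec _≟_ a origin
... | no a≢0 = far-component a≢0 v∉
... | yes refl with classify ⟨ b , c ⟩
...   | inj₁ u∈square        = square-component u∈square
...   | inj₂ (inj₁ u∈∂square) = ⊥-elim (v∉ (∈cut-∂square u∈∂square))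
...   | inj₂ (inj₂ refl)     = corner-component {a = 1₃ ∷ origin} (adj-head λ ())

theorem3p5 : ∀ (n : ℕ) → 3 ≤ n → κ_≤_ (Q3 n) 3 (8 * n ∸ 12)
theorem3p5 _ (s≤s (s≤s (s≤s {n = k} _))) =
  cutSet (suc k) , (cut-disconnects , cut-component k) , ≤-reflexive (length-cut (suc k))
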